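{- Every blowup of a thin spider or of the complement of a thin spider is recolorable.
   Context: Graphs are finite and simple. A thin spider is a graph whose vertex set can be partitioned into a clique $K$ and an independent set $S$ with $|K|=|S|$ or $|K|=|S|+1$, such that the edges between $S$ and $K$ form a matching and at most one vertex of $K$ has no neighbor in $S$. A blowup of a graph $G$ is a graph obtained from $G$ by substituting non-empty cliques for some of its vertices (substituting a clique $Q$ for $v$ means deleting $v$ and adding $Q$ with every vertex of $Q$ adjacent to every former neighbor of $v$). A $k$-coloring of $G$ is a map $V(G)\to\{1,\dots,k\}$ giving adjacent vertices different colors; $\chi(G)$ is the chromatic number. $R_\ell(G)$ is the graph whose vertices are the $\ell$-colorings of $G$, two adjacent if they differ on exactly one vertex. $G$ is recolorable if $R_\ell(G)$ is connected for every $\ell\ge\chi(G)+1$. -}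

module Defs where

open import Data.Nat using (ℕ; zero; suc; _+_; _≤_)
open import Data.Fin using (Fin; zero; suc; _≟_)
open import Data.Bool using (Bool; true; false; not; if_then_else_)
open import Data.Product using (Σ; ∃; _×_; _,_)
open import Data.Sum using (_⊎_)
open import Data.Empty using (⊥-elim)
open import Relation.Nullary using (¬_; yes; no)
open import Relation.Binary.PropositionalEquality using (_≡_; _≢_; refl)
open import Relation.Binary.Construct.Closure.ReflexiveTransitive using (Star)
open import Function.Bundles using (_⇔_)

record Graph (n : ℕ) : Set where
  field
    adj   : Fin n → Fin n → Bool
    adj-sym    : ∀ u v → adj u v ≡ adj v u
    adj-irrefl : ∀ v → adj v v ≡ false
open Graph public

_∼[_]_ : ∀ {n} → Fin n → Graph n → Fin n → Set
u ∼[ G ] v = adj G u v ≡ true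

private
  compAdj : ∀ {n} → Graph n → Fin n → Fin n → Bool
  compAdj G u v with u ≟ v
  ... | yes _ = false
  ... | no _  = not (adj G u v)

  compSym : ∀ {n} (G : Graph n) u v → compAdj G u v ≡ compAdj G v u
  compSym G u v with u ≟ v | v ≟ u
  ... | yes _ | yes _ = refl
  ... | yes refl | no q = ⊥-elim (q refl)
  ... | no p | yes refl = ⊥-elim (p refl)
  ... | no _ | no _ rewrite Graph.adj-sym G u v = refl

  compIrr : ∀ {n} (G : Graph n) v → compAdj G v v ≡ false
  compIrr G v with v ≟ v
  ... | yes _ = refl
  ... | no p = ⊥-elim (p refl)

complement : ∀ {n} → Graph n → Graph n
complement G = record { adj = compAdj G ; adj-sym = compSym G ; adj-irrefl = compIrr G }

card : ∀ {n} → (Fin n → Bool) → ℕ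
card {zero}  P = 0
card {suc n} P = (if P zero then 1 else 0) + card (λ i → P (suc i))

inK inS : ∀ {n} → (Fin n → Bool) → Fin n → Set
inK part v = part v ≡ true
inS part v = part v ≡ false

record ThinSpiderPartition {n} (G : Graph n) (part : Fin n → Bool) : Set where
  field
    clique      : ∀ u v → inK part u → inK part v → u ≢ v → u ∼[ G ] v
    stable      : ∀ u v → inS part u → inS part v → ¬ (u ∼[ G ] v)
    sizes       : card part ≡ card (λ v → not (part v))
                  ⊎ card part ≡ suc (card (λ v → not (part v)))
    matchingS   : ∀ s k k′ → inS part s → inK part k → inK part k′ →
                  s ∼[ G ] k → s ∼[ G ] k′ → k ≡ k′
    matchingK   : ∀ k s s′ → inK part k → inS part s → inS part s′ →
                  k ∼[ G ] s → k ∼[ G ] s′ → s ≡ s′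
    atMostOneLonely : ∀ k k′ → inK part k → inK part k′ →
                  (∀ s → inS part s → ¬ (k ∼[ G ] s)) →
                  (∀ s → inS part s → ¬ (k′ ∼[ G ] s)) → k ≡ k′

ThinSpider : ∀ {n} → Graph n → Set
ThinSpider G = ∃ λ part → ThinSpiderPartition G part

-- H is (isomorphic to) a blowup of G: V(H) is partitioned into non-empty
-- cliques Q_x = f⁻¹(x), x ∈ V(G), with Q_x complete to Q_y iff xy ∈ E(G)
-- and anticomplete otherwise.
IsBlowup : ∀ {m n} → Graph m → Graph n → Set
IsBlowup {m} {n} H G =
  Σ (Fin m → Fin n) λ f →
    (∀ x → ∃ λ u → f u ≡ x) ×
    (∀ u v → u ≢ v → (u ∼[ H ] v ⇔ (f u ≡ f v ⊎ f u ∼[ G ] f v)))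

IsColoring : ∀ {n} (G : Graph n) (k : ℕ) → (Fin n → Fin k) → Set
IsColoring G k c = ∀ u v → u ∼[ G ] v → c u ≢ c v

Colorable : ∀ {n} → Graph n → ℕ → Set
Colorable G k = ∃ λ c → IsColoring G k c

IsChromaticNumber : ∀ {n} → Graph n → ℕ → Set
IsChromaticNumber G k = Colorable G k × (∀ j → Colorable G j → k ≤ j)

DifferOnExactlyOne : ∀ {n k} → (Fin n → Fin k) → (Fin n → Fin k) → Set
DifferOnExactlyOne c d = ∃ λ v → c v ≢ d v × (∀ w → w ≢ v → c w ≡ d w)

-- One step in R_ℓ(G) (vertices of R_ℓ(G) are colourings as maps, so
-- pointwise equal maps are the same vertex).
RStep : ∀ {n} (G : Graph n) (ℓ : ℕ) → (Fin n → Fin ℓ) → (Fin n → Fin ℓ) → Set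
RStep G ℓ c d = IsColoring G ℓ c × IsColoring G ℓ d ×
                ((∀ v → c v ≡ d v) ⊎ DifferOnExactlyOne c d)

RConnected : ∀ {n} → Graph n → ℕ → Set
RConnected G ℓ = ∀ c d → IsColoring G ℓ c → IsColoring G ℓ d → Star (RStep G ℓ) c d

Recolorable : ∀ {n} → Graph n → Set
Recolorable G = ∀ χ → IsChromaticNumber G χ → ∀ ℓ → suc χ ≤ ℓ → RConnected G ℓ

{-# OPTIONS --safe #-}
-- Thin spiders and their complements are split graphs, and a blowup of a split
-- graph is chordal: listing first the vertices over the stable side and then
-- those over the clique, every vertex is simplicial among the later ones (a
-- vertex over the stable side has only its true twins and clique-side vertices
-- as neighbours). Chordal graphs are recolorable by induction along such a
-- perfect elimination order: a recoloring sequence of the later vertices is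
-- lifted to one that also colors the eliminated vertex v. The neighbours of v
-- among the later vertices form a clique with v, so they use fewer than χ colors;
-- with ℓ > χ colors v can always move to a color avoiding both them and the one
-- new color about to appear on a neighbour.
module Submission where

open import Defs
open import Data.Nat using (ℕ; _<_)
open import Data.Fin using (Fin; _≟_)
open import Data.Fin.Properties using (pigeonhole; <⇒≢; any?; ¬∀⟶∃¬)
open import Data.Bool using (Bool; true; false; not)
open import Data.Bool.Properties using (not-injective; not-¬; ¬-not) renaming (_≟_ to _≟ᵇ_)
open import Data.Product using (∃; _×_; _,_; proj₁; proj₂)
open import Data.Sum using (_⊎_; inj₁; inj₂; [_,_])
open import Data.Unit using (⊤; tt)
open import Data.List using (List; []; _∷_; _++_; filter; allFin)
open import Data.List.Relation.Unary.Any using (here; there)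
open import Data.List.Relation.Unary.All as All using (All; []; _∷_)
open import Data.List.Relation.Unary.All.Properties using (all-filter)
open import Data.List.Membership.Propositional using (_∈_)
import Data.List.Membership.DecPropositional as DecMembership
open import Data.List.Membership.Propositional.Properties
  using (∈-++⁺ˡ; ∈-++⁺ʳ; ∈-filter⁺; ∈-allFin)
open import Data.Vec.Functional using (updateAt)
open import Data.Vec.Functional.Properties
  using (updateAt-updates; updateAt-minimal; updateAt-id-local)
open import Function using (_∘_; const)
open import Function.Bundles using (Equivalence)
open import Relation.Nullary using (¬_; Dec; yes; no; contradiction)
open import Relation.Nullary.Decidable using (_×-dec_; _⊎-dec_)
open import Relation.Binary.PropositionalEquality
  using (_≡_; _≢_; refl; sym; trans; cong; subst)
open import Relation.Binary.Construct.Closure.ReflexiveTransitive as Star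
  using (Star; ε; _◅_; _◅◅_)

∼-sym : ∀ {n} (G : Graph n) {u v} → u ∼[ G ] v → v ∼[ G ] u
∼-sym G {u} {v} u∼v = trans (adj-sym G v u) u∼v

∼⇒≢ : ∀ {n} (G : Graph n) {u v} → u ∼[ G ] v → u ≢ v
∼⇒≢ G {u} u∼u refl = contradiction (trans (sym (adj-irrefl G u)) u∼u) λ ()

complement-adj : ∀ {n} (G : Graph n) {u v} → u ≢ v →
                 adj (complement G) u v ≡ not (adj G u v)
complement-adj G {u} {v} u≢v with u ≟ v
... | yes u≡v = contradiction u≡v u≢v
... | no _    = refl

record SplitPartition {n} (G : Graph n) (part : Fin n → Bool) : Set where
  field
    clique : ∀ u v → inK part u → inK part v → u ≢ v → u ∼[ G ] v
    stable : ∀ u v → inS part u → inS part v → ¬ (u ∼[ G ] v)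

thinSpider⇒split : ∀ {n} {G : Graph n} {part} →
                   ThinSpiderPartition G part → SplitPartition G part
thinSpider⇒split spider = record { clique = clique ; stable = stable }
  where open ThinSpiderPartition spider

complement-split : ∀ {n} (G : Graph n) {part} →
                   SplitPartition (complement G) part → SplitPartition G (not ∘ part)
complement-split G {part} split = record { clique = clique′ ; stable = stable′ }
  where
    open SplitPartition split

    clique′ : ∀ u v → inK (not ∘ part) u → inK (not ∘ part) v → u ≢ v → u ∼[ G ] v
    clique′ u v u∈K v∈K u≢v = not-injective (¬-not (not-adj ∘ trans (complement-adj G u≢v)))
      where not-adj = stable u v (not-injective u∈K) (not-injective v∈K)

    stable′ : ∀ u v → inS (not ∘ part) u → inS (not ∘ part) v → ¬ (u ∼[ G ] v)
    stable′ u v u∈S v∈S u∼v = not-¬ (cong not u∼v) (trans (sym (complement-adj G u≢v)) adj′)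
      where
        u≢v = ∼⇒≢ G u∼v
        adj′ = clique u v (not-injective u∈S) (not-injective v∈S) u≢v

module _ {m} (H : Graph m) where

  Simplicial : (Fin m → Set) → Fin m → Set
  Simplicial U v = ∀ a b → U a → U b → a ≢ b → a ∼[ H ] v → b ∼[ H ] v → a ∼[ H ] b

  PerfectEliminationOrder : List (Fin m) → Set
  PerfectEliminationOrder []       = ⊤
  PerfectEliminationOrder (v ∷ vs) = Simplicial (_∈ vs) v × PerfectEliminationOrder vs

module _ {m} {H : Graph m} where

  clique⇒perfectEliminationOrder :
    ∀ {P : Fin m → Set} → (∀ {a b} → P a → P b → a ≢ b → a ∼[ H ] b) →
    ∀ {vs} → All P vs → PerfectEliminationOrder H vs
  clique⇒perfectEliminationOrder adjacent []         = tt
  clique⇒perfectEliminationOrder adjacent (_ ∷ P-vs) =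
    (λ a b a∈ b∈ a≢b _ _ → adjacent (All.lookup P-vs a∈) (All.lookup P-vs b∈) a≢b) ,
    clique⇒perfectEliminationOrder adjacent P-vs

  ++-perfectEliminationOrder :
    ∀ {us vs} → All (λ u → ∀ U → Simplicial H U u) us →
    PerfectEliminationOrder H vs → PerfectEliminationOrder H (us ++ vs)
  ++-perfectEliminationOrder []                     peo = peo
  ++-perfectEliminationOrder (simplicial ∷ us-simp) peo =
    simplicial _ , ++-perfectEliminationOrder us-simp peo

module Reconfiguration {m} (H : Graph m) (ℓ : ℕ) where

  open DecMembership (_≟_ {m}) using (_∈?_)

  Coloring : Set
  Coloring = Fin m → Fin ℓ

  _[_]≔_ : Coloring → Fin m → Fin ℓ → Coloring
  c [ v ]≔ x = updateAt c v (const x)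

  SameOrDifferAtOne : Coloring → Coloring → Set
  SameOrDifferAtOne c d = (∀ v → c v ≡ d v) ⊎ DifferOnExactlyOne c d

  ProperOn : (Fin m → Set) → Coloring → Set
  ProperOn U c = ∀ a b → U a → U b → a ∼[ H ] b → c a ≢ c b

  StepOn : (Fin m → Set) → Coloring → Coloring → Set
  StepOn U c d = ProperOn U c × ProperOn U d × SameOrDifferAtOne c d

  ReconfigurableOn : (Fin m → Set) → Set
  ReconfigurableOn U = ∀ α β → ProperOn U α → ProperOn U β →
                       ∃ λ γ → Star (StepOn U) α γ × (∀ w → U w → γ w ≡ β w)

  Available : (Fin m → Set) → Fin m → Coloring → Fin ℓ → Set
  Available U v c x = ∀ a → U a → a ∼[ H ] v → c a ≢ x

  proper-⊆ : ∀ {U V c} → (∀ {w} → U w → V w) → ProperOn V c → ProperOn U c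
  proper-⊆ U⊆V proper a b a∈U b∈U = proper a b (U⊆V a∈U) (U⊆V b∈U)

  proper-cong : ∀ {U c d} → (∀ a → U a → c a ≡ d a) → ProperOn U c → ProperOn U d
  proper-cong c≈d proper a b a∈U b∈U a∼b e =
    proper a b a∈U b∈U a∼b (trans (c≈d a a∈U) (trans e (sym (c≈d b b∈U))))

  available-cong : ∀ {U v c d x} → (∀ a → U a → c a ≡ d a) →
                   Available U v c x → Available U v d x
  available-cong c≈d free a a∈U a∼v = free a a∈U a∼v ∘ trans (c≈d a a∈U)

  ≔-pointwise : ∀ {c d v x} w → (w ≢ v → c w ≡ d w) → (c [ v ]≔ x) w ≡ (d [ v ]≔ x) w
  ≔-pointwise {c} {d} {v} w agree with w ≟ v
  ... | yes refl = trans (updateAt-updates w c) (sym (updateAt-updates w d))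
  ... | no w≢v   = trans (updateAt-minimal w v c w≢v)
                         (trans (agree w≢v) (sym (updateAt-minimal w v d w≢v)))

  ≔-recolor : ∀ c v x y → SameOrDifferAtOne (c [ v ]≔ x) (c [ v ]≔ y)
  ≔-recolor c v x y with x ≟ y
  ... | yes refl = inj₁ λ _ → refl
  ... | no x≢y   = inj₂ (v , cx≢cy , λ w w≢v →
                     trans (updateAt-minimal w v c w≢v) (sym (updateAt-minimal w v c w≢v)))
    where
      cx≢cy : (c [ v ]≔ x) v ≢ (c [ v ]≔ y) v
      cx≢cy e = x≢y (trans (sym (updateAt-updates v c)) (trans e (updateAt-updates v c)))

  ≔-differAt : ∀ {c d v x u} → u ≢ v → c u ≢ d u → (∀ w → w ≢ u → c w ≡ d w) →
               DifferOnExactlyOne (c [ v ]≔ x) (d [ v ]≔ x)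
  ≔-differAt {c} {d} {v} {u = u} u≢v cu≢du agree =
    u , (λ e → cu≢du (trans (sym (updateAt-minimal u v c u≢v))
                            (trans e (updateAt-minimal u v d u≢v)))) ,
    λ w w≢u → ≔-pointwise w λ _ → agree w w≢u

  ReconfigurableOn-cong : ∀ {U V} → (∀ {w} → U w → V w) → (∀ {w} → V w → U w) →
                          ReconfigurableOn U → ReconfigurableOn V
  ReconfigurableOn-cong {U} {V} U⊆V V⊆U reconf α β α-proper β-proper
    with reconf α β (proper-⊆ U⊆V α-proper) (proper-⊆ U⊆V β-proper)
  ... | γ , path , γ≈β = γ , Star.map toV path , λ w w∈V → γ≈β w (V⊆U w∈V)
    where
      toV : ∀ {c d} → StepOn U c d → StepOn V c d
      toV (c-proper , d-proper , close) = proper-⊆ V⊆U c-proper , proper-⊆ V⊆U d-proper , close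

  reconfigurable⇒rConnected : ∀ {U} → (∀ w → U w) → ReconfigurableOn U → RConnected H ℓ
  reconfigurable⇒rConnected {U} everywhere reconf c d c-coloring d-coloring
    with reconf c d (λ a b _ _ → c-coloring a b) (λ a b _ _ → d-coloring a b)
  ... | γ , path , γ≈d = Star.map toRStep path ◅◅ (γ-coloring , d-coloring , inj₁ γ≈d′) ◅ ε
    where
      coloring : ∀ {c} → ProperOn U c → IsColoring H ℓ c
      coloring proper a b = proper a b (everywhere a) (everywhere b)

      γ≈d′ : ∀ w → γ w ≡ d w
      γ≈d′ w = γ≈d w (everywhere w)

      γ-coloring : IsColoring H ℓ γ
      γ-coloring = coloring (proper-cong (λ w _ → sym (γ≈d′ w)) (λ a b _ _ → d-coloring a b))

      toRStep : ∀ {c d} → StepOn U c d → RStep H ℓ c d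
      toRStep (c-proper , d-proper , close) = coloring c-proper , coloring d-proper , close

  -- The vertices blocking a color (the given color z, charged to v itself, and
  -- the colors of neighbours of v in U) have pairwise distinct κ-colors, as they
  -- span a clique; so fewer than ℓ colors are blocked.
  spareColor : ∀ {χ U v} → Colorable H χ → χ < ℓ → (∀ a → Dec (U a)) → Simplicial H U v →
               ∀ c z → ∃ λ y → Available U v c y × y ≢ z
  spareColor {χ} {U} {v} (κ , κ-proper) χ<ℓ U? simplicial c z =
    y , (λ a a∈U a∼v ca≡y → y-free (inj₂ (a , a∈U , a∼v , ca≡y))) ,
    (λ y≡z → y-free (inj₁ (sym y≡z)))
    where
      Blocked : Fin ℓ → Set
      Blocked y = z ≡ y ⊎ ∃ λ a → U a × a ∼[ H ] v × c a ≡ y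

      blocked? : ∀ y → Dec (Blocked y)
      blocked? y = (z ≟ y) ⊎-dec any? λ a → U? a ×-dec (adj H a v ≟ᵇ true) ×-dec (c a ≟ y)

      blocker : ∀ {y} → Blocked y → Fin χ
      blocker (inj₁ _)       = κ v
      blocker (inj₂ (a , _)) = κ a

      blocker-injective : ∀ {x y} (p : Blocked x) (q : Blocked y) → blocker p ≡ blocker q → x ≡ y
      blocker-injective (inj₁ z≡x) (inj₁ z≡y) _ = trans (sym z≡x) z≡y
      blocker-injective (inj₁ _) (inj₂ (b , _ , b∼v , _)) e =
        contradiction (sym e) (κ-proper b v b∼v)
      blocker-injective (inj₂ (a , _ , a∼v , _)) (inj₁ _) e = contradiction e (κ-proper a v a∼v)
      blocker-injective (inj₂ (a , a∈U , a∼v , ca≡x)) (inj₂ (b , b∈U , b∼v , cb≡y)) e with a ≟ b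
      ... | yes refl = trans (sym ca≡x) cb≡y
      ... | no a≢b   = contradiction e (κ-proper a b (simplicial a b a∈U b∈U a≢b a∼v b∼v))

      not-all-blocked : ¬ (∀ y → Blocked y)
      not-all-blocked all-blocked with pigeonhole χ<ℓ (blocker ∘ all-blocked)
      ... | i , j , i<j , e = <⇒≢ i<j (blocker-injective (all-blocked i) (all-blocked j) e)

      unblocked : ∃ λ y → ¬ Blocked y
      unblocked = ¬∀⟶∃¬ ℓ Blocked blocked? not-all-blocked

      y = proj₁ unblocked
      y-free = proj₂ unblocked

  module Extension {U′ : Fin m → Set} {v : Fin m} (v∉U′ : ¬ U′ v)
                   (spare : ∀ c z → ∃ λ y → Available U′ v c y × y ≢ z) where

    U : Fin m → Set
    U w = U′ w ⊎ w ≡ v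

    ∈U′⇒≢v : ∀ {w} → U′ w → w ≢ v
    ∈U′⇒≢v w∈U′ refl = v∉U′ w∈U′

    ≔-proper : ∀ {c x} → ProperOn U′ c → Available U′ v c x → ProperOn U (c [ v ]≔ x)
    ≔-proper {c} {x} proper free a b (inj₁ a∈U′) (inj₁ b∈U′) a∼b
      rewrite updateAt-minimal a v {const x} c (∈U′⇒≢v a∈U′)
            | updateAt-minimal b v {const x} c (∈U′⇒≢v b∈U′) = proper a b a∈U′ b∈U′ a∼b
    ≔-proper {c} {x} proper free a _ (inj₁ a∈U′) (inj₂ refl) a∼v
      rewrite updateAt-minimal a v {const x} c (∈U′⇒≢v a∈U′)
            | updateAt-updates v {const x} c = free a a∈U′ a∼v
    ≔-proper {c} {x} proper free _ b (inj₂ refl) (inj₁ b∈U′) v∼b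
      rewrite updateAt-minimal b v {const x} c (∈U′⇒≢v b∈U′)
            | updateAt-updates v {const x} c = free b b∈U′ (∼-sym H v∼b) ∘ sym
    ≔-proper proper free _ _ (inj₂ refl) (inj₂ refl) v∼v = contradiction refl (∼⇒≢ H v∼v)

    restrict : ∀ {c} → ProperOn U c → ProperOn U′ c
    restrict = proper-⊆ inj₁

    own-color-available : ∀ {c} → ProperOn U c → Available U′ v c (c v)
    own-color-available proper a a∈U′ a∼v = proper a v (inj₁ a∈U′) (inj₂ refl) a∼v

    available-differAt : ∀ {c d x u} → (∀ w → w ≢ u → c w ≡ d w) → d u ≢ x →
                         Available U′ v c x → Available U′ v d x
    available-differAt {u = u} agree du≢x free a a∈U′ a∼v with a ≟ u
    ... | yes refl = du≢x
    ... | no a≢u   = free a a∈U′ a∼v ∘ trans (agree a a≢u)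

    Lift : Coloring → Fin ℓ → Coloring → Set
    Lift c x d = ∃ λ x′ → Available U′ v d x′ × Star (StepOn U) (c [ v ]≔ x) (d [ v ]≔ x′)

    lift-agreeOff-v : ∀ {c d x} → ProperOn U′ c → ProperOn U′ d → (∀ w → w ≢ v → c w ≡ d w) →
                      Available U′ v c x → Lift c x d
    lift-agreeOff-v {c} {d} {x} c-proper d-proper agree free =
      x , free′ , (≔-proper c-proper free , ≔-proper d-proper free′ , inj₁ same) ◅ ε
      where
        free′ = available-cong (λ a a∈U′ → agree a (∈U′⇒≢v a∈U′)) free
        same = λ w → ≔-pointwise w (agree w)

    lift-differAt : ∀ {c d x u} → ProperOn U′ c → ProperOn U′ d → u ≢ v → c u ≢ d u →
                    (∀ w → w ≢ u → c w ≡ d w) → Available U′ v c x → Lift c x d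
    lift-differAt {c} {d} {x} {u} c-proper d-proper u≢v cu≢du agree free
      with spare c (d u)
    ... | y , c-free , y≢du = y , d-free , recolor-v ◅ recolor-u ◅ ε
      where
        d-free = available-differAt agree (y≢du ∘ sym) c-free
        recolor-v = ≔-proper c-proper free , ≔-proper c-proper c-free , ≔-recolor c v x y
        recolor-u = ≔-proper c-proper c-free , ≔-proper d-proper d-free ,
                    inj₂ (≔-differAt u≢v cu≢du agree)

    liftStep : ∀ {c d x} → StepOn U′ c d → Available U′ v c x → Lift c x d
    liftStep (c-proper , d-proper , inj₁ same) =
      lift-agreeOff-v c-proper d-proper λ w _ → same w
    liftStep (c-proper , d-proper , inj₂ (u , cu≢du , agree)) with u ≟ v
    ... | yes refl = lift-agreeOff-v c-proper d-proper agree
    ... | no u≢v   = lift-differAt c-proper d-proper u≢v cu≢du agree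

    liftPath : ∀ {c d x} → Star (StepOn U′) c d → Available U′ v c x → Lift c x d
    liftPath ε            free = _ , free , ε
    liftPath (step ◅ path) free with liftStep step free
    ... | x′ , free′ , lifted with liftPath path free′
    ...   | x″ , free″ , rest = x″ , free″ , lifted ◅◅ rest

    extend : ReconfigurableOn U′ → ReconfigurableOn U
    extend reconf α β α-proper β-proper with reconf α β (restrict α-proper) (restrict β-proper)
    ... | γ , path , γ≈β with liftPath path (own-color-available α-proper)
    ...   | x′ , γ-free , lifted = γ [ v ]≔ β v , start ◅ lifted ◅◅ finish ◅ ε , agrees
      where
        β≈γ : ∀ w → U′ w → β w ≡ γ w
        β≈γ w w∈U′ = sym (γ≈β w w∈U′)

        γ-proper : ProperOn U′ γ
        γ-proper = proper-cong β≈γ (restrict β-proper)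

        start : StepOn U α (α [ v ]≔ α v)
        start = α-proper , ≔-proper (restrict α-proper) (own-color-available α-proper) ,
                inj₁ λ w → sym (updateAt-id-local v α refl w)

        finish : StepOn U (γ [ v ]≔ x′) (γ [ v ]≔ β v)
        finish = ≔-proper γ-proper γ-free ,
                 ≔-proper γ-proper (available-cong β≈γ (own-color-available β-proper)) ,
                 ≔-recolor γ v x′ (β v)

        agrees : ∀ w → U w → (γ [ v ]≔ β v) w ≡ β w
        agrees w (inj₁ w∈U′) = trans (updateAt-minimal w v γ (∈U′⇒≢v w∈U′)) (γ≈β w w∈U′)
        agrees w (inj₂ refl) = updateAt-updates w γ

  ∷-reconfigurable : ∀ {χ v vs} → Colorable H χ → χ < ℓ → Simplicial H (_∈ vs) v →
                     ReconfigurableOn (_∈ vs) → ReconfigurableOn (_∈ v ∷ vs)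
  ∷-reconfigurable {v = v} {vs} colorable χ<ℓ simplicial reconf with v ∈? vs
  ... | yes v∈vs =
    ReconfigurableOn-cong there (λ { (here refl) → v∈vs ; (there w∈vs) → w∈vs }) reconf
  ... | no v∉vs  =
    ReconfigurableOn-cong [ there , here ] (λ { (here w≡v) → inj₂ w≡v ; (there w∈vs) → inj₁ w∈vs })
      (Extension.extend v∉vs (spareColor colorable χ<ℓ (_∈? vs) simplicial) reconf)

  perfectEliminationOrder⇒reconfigurable : ∀ {χ} → Colorable H χ → χ < ℓ →
    ∀ vs → PerfectEliminationOrder H vs → ReconfigurableOn (_∈ vs)
  perfectEliminationOrder⇒reconfigurable colorable χ<ℓ []       _ α β _ _ = α , ε , λ _ ()
  perfectEliminationOrder⇒reconfigurable colorable χ<ℓ (v ∷ vs) (simplicial , peo) =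
    ∷-reconfigurable colorable χ<ℓ simplicial
      (perfectEliminationOrder⇒reconfigurable colorable χ<ℓ vs peo)

perfectEliminationOrder⇒recolorable : ∀ {m} {H : Graph m} vs →
  PerfectEliminationOrder H vs → (∀ w → w ∈ vs) → Recolorable H
perfectEliminationOrder⇒recolorable {H = H} vs peo everywhere χ (colorable , _) ℓ χ<ℓ =
  reconfigurable⇒rConnected everywhere (perfectEliminationOrder⇒reconfigurable colorable χ<ℓ vs peo)
  where open Reconfiguration H ℓ

module SplitBlowup {m n} {G : Graph n} {H : Graph m} {part : Fin n → Bool}
                   (split : SplitPartition G part) (blowup : IsBlowup H G) where

  open SplitPartition split

  π : Fin m → Fin n
  π = proj₁ blowup

  adj⁺ : ∀ {a b} → a ≢ b → π a ≡ π b ⊎ π a ∼[ G ] π b → a ∼[ H ] b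
  adj⁺ {a} {b} a≢b = Equivalence.from (proj₂ (proj₂ blowup) a b a≢b)

  adj⁻ : ∀ {a b} → a ∼[ H ] b → π a ≡ π b ⊎ π a ∼[ G ] π b
  adj⁻ {a} {b} a∼b = Equivalence.to (proj₂ (proj₂ blowup) a b (∼⇒≢ H a∼b)) a∼b

  overClique-adjacent : ∀ {a b} → inK part (π a) → inK part (π b) → a ≢ b → a ∼[ H ] b
  overClique-adjacent {a} {b} a∈K b∈K a≢b with π a ≟ π b
  ... | yes πa≡πb = adj⁺ a≢b (inj₁ πa≡πb)
  ... | no πa≢πb  = adj⁺ a≢b (inj₂ (clique (π a) (π b) a∈K b∈K πa≢πb))

  overStable-neighbour-twin : ∀ {a v} → inS part (π a) → inS part (π v) → a ∼[ H ] v → π a ≡ π v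
  overStable-neighbour-twin {a} {v} a∈S v∈S a∼v with adj⁻ a∼v
  ... | inj₁ πa≡πv = πa≡πv
  ... | inj₂ πa∼πv = contradiction πa∼πv (stable (π a) (π v) a∈S v∈S)

  twin-adjacent : ∀ {a b v} → a ≢ b → π a ≡ π v → b ∼[ H ] v → a ∼[ H ] b
  twin-adjacent {a} {b} {v} a≢b πa≡πv b∼v with adj⁻ b∼v
  ... | inj₁ πb≡πv = adj⁺ a≢b (inj₁ (trans πa≡πv (sym πb≡πv)))
  ... | inj₂ πb∼πv = adj⁺ a≢b (inj₂ (subst (_∼[ G ] π b) (sym πa≡πv) (∼-sym G πb∼πv)))

  overStable-simplicial : ∀ {v} → inS part (π v) → ∀ U → Simplicial H U v
  overStable-simplicial v∈S U a b _ _ a≢b a∼v b∼v with part (π a) in πa | part (π b) in πb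
  ... | false | _     = twin-adjacent a≢b (overStable-neighbour-twin πa v∈S a∼v) b∼v
  ... | true  | false =
    ∼-sym H (twin-adjacent (a≢b ∘ sym) (overStable-neighbour-twin πb v∈S b∼v) a∼v)
  ... | true  | true  = overClique-adjacent πa πb a≢b

  overStable? : ∀ w → Dec (inS part (π w))
  overStable? w = part (π w) ≟ᵇ false

  overClique? : ∀ w → Dec (inK part (π w))
  overClique? w = part (π w) ≟ᵇ true

  eliminationOrder : List (Fin m)
  eliminationOrder = filter overStable? (allFin m) ++ filter overClique? (allFin m)

  perfectEliminationOrder : PerfectEliminationOrder H eliminationOrder
  perfectEliminationOrder = ++-perfectEliminationOrder {H = H}
    (All.map overStable-simplicial (all-filter overStable? (allFin m)))
    (clique⇒perfectEliminationOrder overClique-adjacent (all-filter overClique? (allFin m)))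

  ∈-eliminationOrder : ∀ w → w ∈ eliminationOrder
  ∈-eliminationOrder w with part (π w) in πw
  ... | false = ∈-++⁺ˡ (∈-filter⁺ overStable? (∈-allFin w) πw)
  ... | true  = ∈-++⁺ʳ _ (∈-filter⁺ overClique? (∈-allFin w) πw)

split-blowup-recolorable : ∀ {m n} (G : Graph n) (H : Graph m) {part} →
                           SplitPartition G part → IsBlowup H G → Recolorable H
split-blowup-recolorable G H split blowup =
  perfectEliminationOrder⇒recolorable {H = H}
    eliminationOrder perfectEliminationOrder ∈-eliminationOrder
  where open SplitBlowup split blowup

lemma16 : ∀ {m n} (G : Graph n) (H : Graph m) →
          ThinSpider G ⊎ ThinSpider (complement G) →
          IsBlowup H G → Recolorable H
lemma16 G H (inj₁ (_ , spider)) =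
  split-blowup-recolorable G H (thinSpider⇒split spider)
lemma16 G H (inj₂ (_ , spider)) =
  split-blowup-recolorable G H (complement-split G (thinSpider⇒split spider))
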